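{- Let $k\ge 2$. If $n=3b$ for some positive integer $b$, then $va^\equiv_1(K_{k*n})=p(kb:k*n)$.
   Context: All graphs are finite and simple. For a graph $G$ with $N=|V(G)|$ vertices, an equitable $q$-coloring of $G$ is a partition of $V(G)$ into $q$ (possibly empty) independent sets, each of size $\lfloor N/q\rfloor$ or $\lceil N/q\rceil$. An equitable $(q,r)$-tree-coloring of $G$ is a partition of $V(G)$ into $q$ sets, each of size $\lfloor N/q\rfloor$ or $\lceil N/q\rceil$, such that each set induces a forest of maximum degree at most $r$. The strong equitable vertex $r$-arboricity $va^\equiv_r(G)$ is the minimum $p$ such that $G$ has an equitable $(q,r)$-tree-coloring for every integer $q\ge p$. $K_{n_1,\ldots,n_k}$ is the complete $k$-partite graph with partite sets of sizes $n_1,\ldots,n_k$, and $K_{k*n}$ denotes the complete $k$-partite graph with every partite set of size $n$. Definition of $p$: suppose $K_{n_1,\ldots,n_k}$ has an equitable $q$-coloring. Then $p(q:n_1,\ldots,n_k)=\lceil n_1/d\rceil+\cdots+\lceil n_k/d\rceil$, where $d$ is the minimum integer with $d\ge\lceil (n_1+\cdots+n_k)/q\rceil$ satisfying at least one of: (i) there exist $i\ne j$ such that neither $n_i$ nor $n_j$ is divisible by $d$; (ii) there exists $i$ with $n_i/\lfloor n_i/d\rfloor>d+1$. Also $p(q:k*n)$ denotes $p(q:n,\ldots,n)$ with $k$ entries equal to $n$. -}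

module Defs where

open import Data.Nat using (ℕ; zero; suc; _+_; _*_; _≤_; _<_; _/_)
open import Data.Nat.Divisibility using (_∣_)
open import Data.Nat.ListAction using (sum)
open import Data.Fin as Fin using (Fin; _≟_; quotient)
open import Data.Bool using (Bool; true; false; T; not)
open import Data.List using (List; []; _∷_; tabulate; length; filterᵇ; map; lookup; replicate)
open import Data.List.Relation.Unary.All using (All)
open import Data.List.Relation.Unary.Unique.Propositional using (Unique)
open import Data.Product using (Σ; ∃; _×_; _,_)
open import Data.Sum using (_⊎_)
open import Data.Empty using (⊥)
open import Relation.Nullary using (¬_; does)
open import Relation.Binary.PropositionalEquality using (_≡_; _≢_)

-- ceiling division ⌈ m / d ⌉ (junk value 0 when d = 0; never used at d = 0)
⌈_/_⌉ : ℕ → ℕ → ℕ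
⌈ m / zero ⌉ = 0
⌈ m / suc d ⌉ = (m + d) / suc d

record Graph (N : ℕ) : Set where
  field
    adj    : Fin N → Fin N → Bool
    sym    : ∀ u v → adj u v ≡ adj v u
    irrefl : ∀ v → adj v v ≡ false
open Graph public using (adj)

allV : (N : ℕ) → List (Fin N)
allV N = tabulate (λ i → i)

-- complete k-partite graph K_{k*n}: vertex i ∈ Fin (k * n) lies in part
-- quotient n i ∈ Fin k; two vertices are adjacent iff they lie in different parts
part : (k n : ℕ) → Fin (k * n) → Fin k
part k n = quotient {k} n

Kkn : (k n : ℕ) → Graph (k * n)
Kkn k n = record
  { adj    = λ u v → not (does (part k n u ≟ part k n v))
  ; sym    = symP
  ; irrefl = irr
  }
  where
  open import Relation.Nullary using (yes; no)
  open import Relation.Binary.PropositionalEquality using (refl; sym)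
  symP : ∀ u v → not (does (part k n u ≟ part k n v))
                 ≡ not (does (part k n v ≟ part k n u))
  symP u v with part k n u ≟ part k n v | part k n v ≟ part k n u
  ... | yes _ | yes _ = refl
  ... | no _  | no _  = refl
  ... | yes p | no q  = Data.Empty.⊥-elim (q (sym p))
    where import Data.Empty
  ... | no p  | yes q = Data.Empty.⊥-elim (p (sym q))
    where import Data.Empty
  irr : ∀ v → not (does (part k n v ≟ part k n v)) ≡ false
  irr v with part k n v ≟ part k n v
  ... | yes _ = refl
  ... | no p  = Data.Empty.⊥-elim (p refl)
    where import Data.Empty

module _ {N : ℕ} (G : Graph N) {q : ℕ} (c : Fin N → Fin q) where

  inClass : Fin q → Fin N → Bool
  inClass i v = does (c v ≟ i)

  classOf : Fin q → List (Fin N)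
  classOf i = filterᵇ (inClass i) (allV N)

  degIn : Fin q → Fin N → ℕ
  degIn i v = length (filterᵇ (adj G v) (classOf i))

  Walk : List (Fin N) → Set
  Walk []           = Data.Unit.⊤ where import Data.Unit
  Walk (x ∷ [])     = Data.Unit.⊤ where import Data.Unit
  Walk (x ∷ y ∷ xs) = T (adj G x y) × Walk (y ∷ xs)

  lastOf : Fin N → List (Fin N) → Fin N
  lastOf x []       = x
  lastOf x (y ∷ ys) = lastOf y ys

  CycleIn : Fin q → Set
  CycleIn i = Σ (Fin N) λ x → Σ (List (Fin N)) λ xs →
      2 ≤ length xs × Unique (x ∷ xs) × All (λ v → T (inClass i v)) (x ∷ xs)
    × Walk (x ∷ xs) × T (adj G (lastOf x xs) x)

  ForestMaxDeg : ℕ → Fin q → Set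
  ForestMaxDeg r i = ¬ CycleIn i × (∀ v → T (inClass i v) → degIn i v ≤ r)

-- size of a class equals ⌊N/q⌋ or ⌈N/q⌉ (q = 0 admits no class at all)
EquitableSize : ℕ → ℕ → ℕ → Set
EquitableSize N zero    s = ⊥
EquitableSize N (suc q) s = s ≡ N / suc q ⊎ s ≡ ⌈ N / suc q ⌉

EqTreeColoring : {N : ℕ} → Graph N → (q r : ℕ) → Set
EqTreeColoring {N} G q r = Σ (Fin N → Fin q) λ c →
  ∀ i → EquitableSize N q (length (classOf G c i)) × ForestMaxDeg G c r i

IsStrongEqVArb : {N : ℕ} → Graph N → (r p : ℕ) → Set
IsStrongEqVArb G r p =
    (∀ q → p ≤ q → EqTreeColoring G q r)
  × (∀ p′ → (∀ q → p′ ≤ q → EqTreeColoring G q r) → p ≤ p′)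

PCond : List ℕ → ℕ → Set
PCond ns zero = ⊥
PCond ns (suc d′) =
    (Σ (Fin (length ns)) λ i → Σ (Fin (length ns)) λ j →
       i ≢ j × ¬ (d ∣ lookup ns i) × ¬ (d ∣ lookup ns j))
  ⊎ (Σ (Fin (length ns)) λ i →
       1 ≤ lookup ns i / d × suc d * (lookup ns i / d) < lookup ns i)
  where d = suc d′

IsMinD : ℕ → List ℕ → ℕ → Set
IsMinD q ns d = ⌈ sum ns / q ⌉ ≤ d × PCond ns d
  × (∀ d′ → ⌈ sum ns / q ⌉ ≤ d′ → d′ < d → ¬ PCond ns d′)

IsP : ℕ → List ℕ → ℕ → Set
IsP q ns v = Σ ℕ λ d → IsMinD q ns d × v ≡ sum (map (λ m → ⌈ m / d ⌉) ns)

-- Let d be the least integer ≥ 4 not dividing n = 3b and a = ⌊n/d⌋. Every integer 3 ≤ e < d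
-- divides n, so no such e satisfies (i) or (ii), and p(kb : k*n) = k⌈n/d⌉ = k(1 + a).
--
-- Upper bound: for q ≥ k(1 + a) put s = ⌊kn/q⌋ and cut the vertex sequence 0, …, kn − 1 of K_{k*n}
-- (parts are blocks of n consecutive vertices) into q consecutive pieces of length s or 1 + s.
-- A piece induces a forest of maximum degree 1 if it has at most two vertices or lies in one part.
-- If s ≤ 2, or q ∣ kn and s ∣ n, the pieces of length at least 3 start at multiples of 3 or of s,
-- which divide n. Otherwise 3 ≤ s < d, so n = s n′, and each part is cut separately into n′ − Y
-- pieces, Y s of them of length 1 + s; this needs Y ≤ ⌊n′/(1 + s)⌋, and q ≥ k(1 + a) keeps the
-- total k n′ − q of the Y's below k⌊n′/(1 + s)⌋.
--
-- Lower bound: for q = k(1 + a) − 1 every class has at least 3 vertices, and a class of maximum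
-- degree 1 in a complete multipartite graph then lies in one part. If J_P classes lie in part P,
-- then s J_P ≤ n ≤ (1 + s) J_P and Σ J_P = q. As a d < n < (1 + a) d, this forces J_P > a for all P
-- when 1 + s ≤ d and J_P ≤ a for all P when d ≤ s; both contradict Σ J_P = k(1 + a) − 1 as k ≥ 2.

module Submission where

open import Defs
open import Data.Nat hiding (_≟_)
open import Data.Nat.Properties hiding (_≟_)
open import Data.Nat.Properties using () renaming (_≟_ to _≟ℕ_)
open import Data.Nat.DivMod
open import Data.Nat.Divisibility using (_∣_; divides; _∣?_; ∣⇒≤; ∣m+n∣m⇒∣n; m∣m*n; m%n≡0⇒n∣m)
open import Algebra.Properties.Semiring.Sum +-*-semiring
  using (sum-syntax; sum-cong-≗; ∑-comm; ∑-distrib-+; *-distribˡ-sum; sum-init-last)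
open import Data.Bool using (Bool; true; false; T; not; _∧_)
open import Data.Fin as Fin using (Fin; toℕ; _≟_)
open import Data.Fin.Properties
  using (toℕ-inject₁; toℕ-fromℕ; toℕ-fromℕ<; toℕ-injective; toℕ<n; toℕ-combine; combine-remQuot)
open import Data.List using ([]; _∷_; tabulate; length; filterᵇ; replicate; map; lookup)
open import Data.List.Properties using (map-replicate)
open import Data.Nat.ListAction using (sum)
open import Data.List.Relation.Unary.All using ([]; _∷_)
open import Data.List.Relation.Unary.AllPairs using (_∷_)
open import Data.Product using (Σ; ∃; _×_; _,_; proj₁; proj₂)
open import Data.Sum as Sum using (_⊎_; inj₁; inj₂)
open import Data.Empty using (⊥)
open import Relation.Nullary using (¬_; does; yes; no; contradiction; Dec; ¬?)
open import Relation.Nullary.Decidable using (decidable-stable)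
open import Relation.Binary.PropositionalEquality
open import Function using (_∘_)
open import Relation.Binary.Definitions using (tri<; tri≈; tri>)
open import Data.Nat.Tactic.RingSolver using (solve-∀)
open import Algebra.Properties.CommutativeSemigroup *-commutativeSemigroup
  using () renaming (x∙yz≈y∙xz to x*[y*z]≡y*[x*z])
open import Algebra.Properties.CommutativeSemigroup +-commutativeSemigroup
  using () renaming (interchange to +-interchange; xy∙z≈xz∙y to x+y+z≡x+z+y)

𝟙 : Bool → ℕ
𝟙 true  = 1
𝟙 false = 0

∑-mono-≤ : ∀ {m} {f g : Fin m → ℕ} → (∀ i → f i ≤ g i) → ∑[ i < m ] f i ≤ ∑[ i < m ] g i
∑-mono-≤ {zero}  f≤g = z≤n
∑-mono-≤ {suc m} f≤g = +-mono-≤ (f≤g Fin.zero) (∑-mono-≤ (f≤g ∘ Fin.suc))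

∑-const : ∀ m c → ∑[ i < m ] c ≡ m * c
∑-const zero    c = refl
∑-const (suc m) c = cong (c +_) (∑-const m c)

∑-toℕ : ∀ N (h : ℕ → ℕ) → ∑[ v < suc N ] h (toℕ v) ≡ ∑[ v < N ] h (toℕ v) + h N
∑-toℕ N h = begin
  ∑[ v < suc N ] h (toℕ v)
    ≡⟨ sum-init-last (λ v → h (toℕ v)) ⟩
  ∑[ v < N ] h (toℕ (Fin.inject₁ v)) + h (toℕ (Fin.fromℕ N))
    ≡⟨ cong₂ _+_ (sum-cong-≗ {N} (λ v → cong h (toℕ-inject₁ v))) (cong h (toℕ-fromℕ N)) ⟩
  ∑[ v < N ] h (toℕ v) + h N
    ∎
  where open ≡-Reasoning

∑-𝟙-≟ : ∀ q (j : Fin q) → ∑[ i < q ] 𝟙 (does (j ≟ i)) ≡ 1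
∑-𝟙-≟ (suc q) Fin.zero    = cong suc (trans (∑-const q 0) (*-zeroʳ q))
∑-𝟙-≟ (suc q) (Fin.suc j) = ∑-𝟙-≟ q j

∑-select : ∀ q (g : Fin q → ℕ) (j : Fin q) → ∑[ i < q ] (g i * 𝟙 (does (j ≟ i))) ≡ g j
∑-select q g j = begin
  ∑[ i < q ] (g i * 𝟙 (does (j ≟ i)))  ≡⟨ sum-cong-≗ {q} g≡gj ⟩
  ∑[ i < q ] (g j * 𝟙 (does (j ≟ i)))  ≡⟨ *-distribˡ-sum {q} (g j) _ ⟨
  g j * ∑[ i < q ] 𝟙 (does (j ≟ i))    ≡⟨ cong (g j *_) (∑-𝟙-≟ q j) ⟩
  g j * 1                              ≡⟨ *-identityʳ (g j) ⟩
  g j                                  ∎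
  where
  open ≡-Reasoning
  g≡gj : ∀ i → g i * 𝟙 (does (j ≟ i)) ≡ g j * 𝟙 (does (j ≟ i))
  g≡gj i with j ≟ i
  ... | yes refl = refl
  ... | no  _    = trans (*-zeroʳ (g i)) (sym (*-zeroʳ (g j)))

∑-fibres : ∀ N q (c : Fin N → Fin q) (g : Fin q → ℕ) →
           ∑[ v < N ] g (c v) ≡ ∑[ i < q ] (g i * ∑[ v < N ] 𝟙 (does (c v ≟ i)))
∑-fibres N q c g = begin
  ∑[ v < N ] g (c v)                                ≡⟨ sum-cong-≗ {N} (λ v → ∑-select q g (c v)) ⟨
  ∑[ v < N ] ∑[ i < q ] (g i * 𝟙 (does (c v ≟ i)))  ≡⟨ ∑-comm (λ v i → g i * 𝟙 (does (c v ≟ i))) ⟩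
  ∑[ i < q ] ∑[ v < N ] (g i * 𝟙 (does (c v ≟ i)))  ≡⟨ sum-cong-≗ {q} (λ i → *-distribˡ-sum {N} (g i) _) ⟨
  ∑[ i < q ] (g i * ∑[ v < N ] 𝟙 (does (c v ≟ i)))  ∎
  where open ≡-Reasoning

∑-𝟙-witness : ∀ {N} (p : Fin N → Bool) → 0 < ∑[ v < N ] 𝟙 (p v) → ∃ λ v → T (p v)
∑-𝟙-witness {suc N} p pos with p Fin.zero in p₀
... | true  = Fin.zero , subst T (sym p₀) _
... | false = let v , pv = ∑-𝟙-witness (p ∘ Fin.suc) pos in Fin.suc v , pv

𝟙-split : ∀ x y → 𝟙 x ≡ 𝟙 (x ∧ y) + 𝟙 (x ∧ not y)
𝟙-split false y     = refl
𝟙-split true  true  = refl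
𝟙-split true  false = refl

inRange : ℕ → ℕ → ℕ → Bool
inRange a b x with a ≤? x | x <? b
... | yes _ | yes _ = true
... | _     | _     = false

inRange-true : ∀ {a b x} → a ≤ x → x < b → inRange a b x ≡ true
inRange-true {a} {b} {x} a≤x x<b with a ≤? x | x <? b
... | yes _   | yes _   = refl
... | no a≰x  | _       = contradiction a≤x a≰x
... | yes _   | no x≮b  = contradiction x<b x≮b

inRange-false : ∀ {a b x} → ¬ (a ≤ x × x < b) → inRange a b x ≡ false
inRange-false {a} {b} {x} ∉ with a ≤? x | x <? b
... | yes a≤x | yes x<b = contradiction (a≤x , x<b) ∉
... | yes _   | no _    = refl
... | no _    | _       = refl

∑-inRange : ∀ N a b → ∑[ v < N ] 𝟙 (inRange a b (toℕ v)) ≡ N ⊓ b ∸ a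
∑-inRange zero    a b = sym (0∸n≡0 a)
∑-inRange (suc N) a b = begin
  ∑[ v < suc N ] 𝟙 (inRange a b (toℕ v))                   ≡⟨ ∑-toℕ N (λ x → 𝟙 (inRange a b x)) ⟩
  ∑[ v < N ] 𝟙 (inRange a b (toℕ v)) + 𝟙 (inRange a b N)  ≡⟨ cong (_+ 𝟙 (inRange a b N)) (∑-inRange N a b) ⟩
  N ⊓ b ∸ a + 𝟙 (inRange a b N)                            ≡⟨ step ⟩
  suc N ⊓ b ∸ a                                            ∎
  where
  open ≡-Reasoning
  step : N ⊓ b ∸ a + 𝟙 (inRange a b N) ≡ suc N ⊓ b ∸ a
  step with a ≤? N | N <? b
  ... | yes a≤N | yes N<b = begin
    N ⊓ b ∸ a + 1    ≡⟨ cong (λ z → z ∸ a + 1) (m≤n⇒m⊓n≡m (<⇒≤ N<b)) ⟩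
    N ∸ a + 1        ≡⟨ +-comm (N ∸ a) 1 ⟩
    suc (N ∸ a)      ≡⟨ +-∸-assoc 1 a≤N ⟨
    suc N ∸ a        ≡⟨ cong (_∸ a) (m≤n⇒m⊓n≡m N<b) ⟨
    suc N ⊓ b ∸ a    ∎
  ... | yes _   | no N≮b  = begin
    N ⊓ b ∸ a + 0    ≡⟨ +-identityʳ _ ⟩
    N ⊓ b ∸ a        ≡⟨ cong (_∸ a) (trans (m≥n⇒m⊓n≡n b≤N) (sym (m≥n⇒m⊓n≡n (m≤n⇒m≤1+n b≤N)))) ⟩
    suc N ⊓ b ∸ a    ∎
    where b≤N = ≮⇒≥ N≮b
  ... | no a≰N  | _       = begin
    N ⊓ b ∸ a + 0    ≡⟨ +-identityʳ _ ⟩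
    N ⊓ b ∸ a        ≡⟨ m≤n⇒m∸n≡0 (≤-trans (m⊓n≤m N b) (<⇒≤ N<a)) ⟩
    0                ≡⟨ m≤n⇒m∸n≡0 (≤-trans (m⊓n≤m (suc N) b) N<a) ⟨
    suc N ⊓ b ∸ a    ∎
    where N<a = ≰⇒> a≰N

length-filterᵇ-tabulate : ∀ {A : Set} N (f : Fin N → A) (p : A → Bool) →
                          length (filterᵇ p (tabulate f)) ≡ ∑[ j < N ] 𝟙 (p (f j))
length-filterᵇ-tabulate zero    f p = refl
length-filterᵇ-tabulate (suc N) f p with p (f Fin.zero)
... | true  = cong suc (length-filterᵇ-tabulate N (λ j → f (Fin.suc j)) p)
... | false = length-filterᵇ-tabulate N (λ j → f (Fin.suc j)) p

filterᵇ-filterᵇ : ∀ {A : Set} (p q : A → Bool) xs → filterᵇ p (filterᵇ q xs) ≡ filterᵇ (λ x → q x ∧ p x) xs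
filterᵇ-filterᵇ p q []       = refl
filterᵇ-filterᵇ p q (x ∷ xs) with q x
... | false = filterᵇ-filterᵇ p q xs
... | true with p x
...   | true  = cong (x ∷_) (filterᵇ-filterᵇ p q xs)
...   | false = filterᵇ-filterᵇ p q xs

lookup-replicate : ∀ m (x : ℕ) (i : Fin (length (replicate m x))) → lookup (replicate m x) i ≡ x
lookup-replicate (suc m) x Fin.zero    = refl
lookup-replicate (suc m) x (Fin.suc i) = lookup-replicate m x i

sum-replicate : ∀ m x → sum (replicate m x) ≡ m * x
sum-replicate zero    x = refl
sum-replicate (suc m) x = cong (x +_) (sum-replicate m x)

m<[1+m/n]*n : ∀ m n .{{_ : NonZero n}} → m < suc (m / n) * n
m<[1+m/n]*n m n = subst (_< n + m / n * n) (sym (m≡m%n+[m/n]*n m n)) (+-monoˡ-< (m / n * n) (m%n<n m n))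

m*n≤o<[1+m]*n⇒o/n≡m : ∀ {m n o} .{{_ : NonZero n}} → m * n ≤ o → o < suc m * n → o / n ≡ m
m*n≤o<[1+m]*n⇒o/n≡m {m} {n} {o} lo hi =
  ≤-antisym (≤-pred (m<n*o⇒m/o<n hi)) (subst (_≤ o / n) (m*n/n≡m m n) (/-monoˡ-≤ n lo))

m%n≢0⇒⌈m/n⌉≡1+m/n : ∀ m q′ → m % suc q′ ≢ 0 → ⌈ m / suc q′ ⌉ ≡ suc (m / suc q′)
m%n≢0⇒⌈m/n⌉≡1+m/n m q′ r≢0 = m*n≤o<[1+m]*n⇒o/n≡m lo hi
  where
  q = suc q′
  s = m / q
  r = m % q
  m+q′≡ : m + q′ ≡ (r + q′) + s * q
  m+q′≡ = trans (cong (_+ q′) (m≡m%n+[m/n]*n m q)) (x+y+z≡x+z+y r (s * q) q′)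
  lo : suc s * q ≤ m + q′
  lo = subst (suc s * q ≤_) (sym m+q′≡) (+-monoˡ-≤ (s * q) (+-monoˡ-≤ q′ (n≢0⇒n>0 r≢0)))
  hi : m + q′ < suc (suc s) * q
  hi = subst (_< suc (suc s) * q) (sym m+q′≡)
         (subst ((r + q′) + s * q <_) (+-assoc q q (s * q))
           (+-monoˡ-< (s * q) (+-mono-<-≤ (m%n<n m q) (n≤1+n q′))))

⌈m*n/n⌉≡m : ∀ m q′ → ⌈ m * suc q′ / suc q′ ⌉ ≡ m
⌈m*n/n⌉≡m m q′ = m*n≤o<[1+m]*n⇒o/n≡m (m≤m+n (m * suc q′) q′)
  (subst (m * suc q′ + q′ <_) (+-comm (m * suc q′) (suc q′)) (+-monoʳ-< (m * suc q′) (n<1+n q′)))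

EquitableSize-bounds : ∀ {N q′ s} → EquitableSize N (suc q′) s → N / suc q′ ≤ s × s ≤ suc (N / suc q′)
EquitableSize-bounds {N} {q′} (inj₁ s≡⌊⌋) = ≤-reflexive (sym s≡⌊⌋) , ≤-trans (≤-reflexive s≡⌊⌋) (n≤1+n _)
EquitableSize-bounds {N} {q′} (inj₂ s≡⌈⌉) =
  subst (N / suc q′ ≤_) (sym s≡⌈⌉) ⌊⌋≤⌈⌉ , subst (_≤ suc (N / suc q′)) (sym s≡⌈⌉) ⌈⌉≤1+⌊⌋
  where
  ⌊⌋≤⌈⌉ : N / suc q′ ≤ (N + q′) / suc q′
  ⌊⌋≤⌈⌉ = /-monoˡ-≤ (suc q′) (m≤m+n N q′)
  ⌈⌉≤1+⌊⌋ : (N + q′) / suc q′ ≤ suc (N / suc q′)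
  ⌈⌉≤1+⌊⌋ = ≤-pred (m<n*o⇒m/o<n (begin-strict
    N + q′                              <⟨ +-monoʳ-< N (n<1+n q′) ⟩
    N + suc q′                          <⟨ +-monoˡ-< (suc q′) (m<[1+m/n]*n N (suc q′)) ⟩
    suc (N / suc q′) * suc q′ + suc q′  ≡⟨ +-comm _ (suc q′) ⟩
    suc (suc (N / suc q′)) * suc q′     ∎))
    where open ≤-Reasoning

least-from : ∀ {P : ℕ → Set} → (∀ x → Dec (P x)) → ∀ t a → P (t + a) →
             ∃ λ d → a ≤ d × P d × (∀ e → a ≤ e → e < d → ¬ P e)
least-from P? t a P[t+a] with P? a
... | yes Pa = a , ≤-refl , Pa , λ e a≤e e<a → contradiction a≤e (<⇒≱ e<a)
least-from P? zero    a Pa       | no ¬Pa = contradiction Pa ¬Pa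
least-from {P} P? (suc t) a P[1+t+a] | no ¬Pa
  with least-from P? t (suc a) (subst P (sym (+-suc t a)) P[1+t+a])
... | d , a<d , Pd , below = d , <⇒≤ a<d , Pd , below′
  where
  below′ : ∀ e → a ≤ e → e < d → ¬ P e
  below′ e a≤e e<d with m≤n⇒m<n∨m≡n a≤e
  ... | inj₁ a<e = below e a<e e<d
  ... | inj₂ refl = ¬Pa

least-non-divisor : ∀ n → .{{_ : NonZero n}} → ∃ λ d → 4 ≤ d × ¬ d ∣ n × (∀ e → 4 ≤ e → e < d → e ∣ n)
least-non-divisor n
  with least-from (λ e → ¬? (e ∣? n)) (suc n) 4 (λ n+5∣n → <⇒≱ (m≤m+n (suc n) 4) (∣⇒≤ n+5∣n))
... | d , 4≤d , d∤n , below = d , 4≤d , d∤n , λ e 4≤e e<d → decidable-stable (e ∣? n) (below e 4≤e e<d)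

a≤x<2+a⇒x≡a⊎x≡1+a : ∀ {a x} → a ≤ x → x < 2 + a → x ≡ a ⊎ x ≡ suc a
a≤x<2+a⇒x≡a⊎x≡1+a a≤x x<2+a with m≤n⇒m<n∨m≡n a≤x
... | inj₂ a≡x = inj₁ (sym a≡x)
... | inj₁ a<x = inj₂ (≤-antisym (≤-pred x<2+a) a<x)

x≢y∈[a,1+a]⇒x+y≡a+[1+a] : ∀ {a x y} → a ≤ x → x < 2 + a → a ≤ y → y < 2 + a → x ≢ y → x + y ≡ a + suc a
x≢y∈[a,1+a]⇒x+y≡a+[1+a] {a} a≤x x<2+a a≤y y<2+a x≢y
  with a≤x<2+a⇒x≡a⊎x≡1+a a≤x x<2+a | a≤x<2+a⇒x≡a⊎x≡1+a a≤y y<2+a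
... | inj₁ refl | inj₁ refl = contradiction refl x≢y
... | inj₁ refl | inj₂ refl = refl
... | inj₂ refl | inj₁ refl = +-comm (suc a) a
... | inj₂ refl | inj₂ refl = contradiction refl x≢y

step≤2⇒narrow : ∀ {a b t} → b ≡ a + t → t ≤ 2 → b ≤ 2 + a
step≤2⇒narrow {a} b≡a+t t≤2 =
  ≤-trans (≤-reflexive b≡a+t) (≤-trans (+-monoʳ-≤ a t≤2) (≤-reflexive (+-comm a 2)))

module _ {N : ℕ} (G : Graph N) {q : ℕ} (c : Fin N → Fin q) where

  length-classOf : ∀ i → length (classOf G c i) ≡ ∑[ v < N ] 𝟙 (inClass G c i v)
  length-classOf i = length-filterᵇ-tabulate N (λ v → v) (inClass G c i)

  degIn-∑ : ∀ i v → degIn G c i v ≡ ∑[ w < N ] 𝟙 (inClass G c i w ∧ adj G v w)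
  degIn-∑ i v = trans (cong length (filterᵇ-filterᵇ (adj G v) (inClass G c i) (allV N)))
                      (length-filterᵇ-tabulate N (λ w → w) (λ w → inClass G c i w ∧ adj G v w))

  independent⇒forest : ∀ {i} r → (∀ u v → T (inClass G c i u) → T (inClass G c i v) → ¬ T (adj G u v)) →
                       ForestMaxDeg G c r i
  independent⇒forest {i} r indep = no-cycle , λ v v∈i → subst (_≤ r) (sym (degIn-∑ i v)) (deg≤ v v∈i)
    where
    no-cycle : ¬ CycleIn G c i
    no-cycle (x , y ∷ _ , _ , _ , x∈i ∷ y∈i ∷ _ , (x~y , _) , _) = indep x y x∈i y∈i x~y
    no-neighbour : ∀ v → T (inClass G c i v) → ∀ w → 𝟙 (inClass G c i w ∧ adj G v w) ≤ 0
    no-neighbour v v∈i w with inClass G c i w in w∈i | adj G v w in v~w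
    ... | false | _     = z≤n
    ... | true  | false = z≤n
    ... | true  | true  = contradiction (subst T (sym v~w) _) (indep v w v∈i (subst T (sym w∈i) _))
    deg≤ : ∀ v → T (inClass G c i v) → ∑[ w < N ] 𝟙 (inClass G c i w ∧ adj G v w) ≤ r
    deg≤ v v∈i = begin
      ∑[ w < N ] 𝟙 (inClass G c i w ∧ adj G v w)  ≤⟨ ∑-mono-≤ (no-neighbour v v∈i) ⟩
      ∑[ w < N ] 0                                ≡⟨ ∑-const N 0 ⟩
      N * 0                                       ≡⟨ *-zeroʳ N ⟩
      0                                           ≤⟨ z≤n ⟩
      r                                           ∎
      where open ≤-Reasoning

  width-two⇒forest : ∀ {i} a → (∀ v → T (inClass G c i v) → a ≤ toℕ v × toℕ v < 2 + a) →
                     ForestMaxDeg G c 1 i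
  width-two⇒forest {i} a narrow = no-cycle , λ v v∈i → subst (_≤ 1) (sym (degIn-∑ i v)) (deg≤ v v∈i)
    where
    sum≡ : ∀ {u w} → T (inClass G c i u) → T (inClass G c i w) → u ≢ w → toℕ u + toℕ w ≡ a + suc a
    sum≡ {u} {w} u∈i w∈i u≢w =
      let a≤u , u<2+a = narrow u u∈i ; a≤w , w<2+a = narrow w w∈i in
      x≢y∈[a,1+a]⇒x+y≡a+[1+a] a≤u u<2+a a≤w w<2+a (u≢w ∘ toℕ-injective)
    no-cycle : ¬ CycleIn G c i
    no-cycle (_ , _ ∷ [] , s≤s () , _)
    no-cycle (x , y ∷ z ∷ _ , _ , (x≢y ∷ x≢z ∷ _) ∷ (y≢z ∷ _) ∷ _ , x∈i ∷ y∈i ∷ z∈i ∷ _ , _) =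
      y≢z (toℕ-injective (+-cancelˡ-≡ (toℕ x) _ _ (trans (sum≡ x∈i y∈i x≢y) (sym (sum≡ x∈i z∈i x≢z)))))
    deg≤ : ∀ v → T (inClass G c i v) → ∑[ w < N ] 𝟙 (inClass G c i w ∧ adj G v w) ≤ 1
    deg≤ v v∈i = begin
      ∑[ w < N ] 𝟙 (inClass G c i w ∧ adj G v w)  ≤⟨ ∑-mono-≤ only-opposite ⟩
      ∑[ w < N ] 𝟙 (inRange o (suc o) (toℕ w))    ≡⟨ ∑-inRange N o (suc o) ⟩
      N ⊓ suc o ∸ o                                ≤⟨ ∸-monoˡ-≤ o (m⊓n≤n N (suc o)) ⟩
      suc o ∸ o                                    ≡⟨ +-∸-assoc 1 (≤-refl {o}) ⟩
      suc (o ∸ o)                                  ≡⟨ cong suc (n∸n≡0 o) ⟩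
      1                                            ∎
      where
      open ≤-Reasoning
      o = a + suc a ∸ toℕ v
      only-opposite : ∀ w → 𝟙 (inClass G c i w ∧ adj G v w) ≤ 𝟙 (inRange o (suc o) (toℕ w))
      only-opposite w with inClass G c i w in w∈i | adj G v w in v~w
      ... | false | _     = z≤n
      ... | true  | false = z≤n
      ... | true  | true  =
        ≤-reflexive (cong 𝟙 (sym (inRange-true (≤-reflexive (sym w≡o)) (s≤s (≤-reflexive w≡o)))))
        where
        v≢w : v ≢ w
        v≢w refl = subst T (trans (sym v~w) (Graph.irrefl G v)) _
        w≡o : toℕ w ≡ o
        w≡o = sym (trans (cong (_∸ toℕ v) (sym (sum≡ v∈i (subst T (sym w∈i) _) v≢w))) (m+n∸m≡n (toℕ v) (toℕ w)))

module _ {k n : ℕ} .{{_ : NonZero n}} where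

  toℕ-part : ∀ v → toℕ (part k n v) ≡ toℕ v / n
  toℕ-part v = sym (m*n≤o<[1+m]*n⇒o/n≡m lo hi)
    where
    P = toℕ (part k n v)
    R = toℕ (Fin.remainder {k} n v)
    v≡ : toℕ v ≡ n * P + R
    v≡ = trans (cong toℕ (sym (combine-remQuot {k} n v))) (toℕ-combine (part k n v) (Fin.remainder {k} n v))
    lo : P * n ≤ toℕ v
    lo = subst₂ _≤_ (*-comm n P) (sym v≡) (m≤m+n (n * P) R)
    hi : toℕ v < suc P * n
    hi = subst₂ _<_ (sym v≡) (trans (+-comm (n * P) n) (cong (n +_) (*-comm n P))) (+-monoʳ-< (n * P) (toℕ<n _))

  Kkn-adj⇒/≢ : ∀ u w → T (adj (Kkn k n) u w) → toℕ u / n ≢ toℕ w / n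
  Kkn-adj⇒/≢ u w u~w u/n≡w/n with part k n u ≟ part k n w
  ... | no Pu≢Pw = Pu≢Pw (toℕ-injective (trans (toℕ-part u) (trans u/n≡w/n (sym (toℕ-part w)))))

  ∑-part : ∀ P → ∑[ v < k * n ] 𝟙 (does (part k n v ≟ P)) ≡ n
  ∑-part P = begin
    ∑[ v < k * n ] 𝟙 (does (part k n v ≟ P))  ≡⟨ sum-cong-≗ {k * n} (cong 𝟙 ∘ inPart≡inRange) ⟩
    ∑[ v < k * n ] 𝟙 (inRange a b (toℕ v))        ≡⟨ ∑-inRange (k * n) a b ⟩
    k * n ⊓ b ∸ a                                 ≡⟨ cong (_∸ a) (m≥n⇒m⊓n≡n (*-monoˡ-≤ n (toℕ<n P))) ⟩
    b ∸ a                                         ≡⟨ m+n∸n≡m n a ⟩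
    n                                             ∎
    where
    open ≡-Reasoning
    a = toℕ P * n
    b = suc (toℕ P) * n
    inPart≡inRange : ∀ v → does (part k n v ≟ P) ≡ inRange a b (toℕ v)
    inPart≡inRange v with part k n v ≟ P
    ... | yes refl = sym (inRange-true lo hi)
      where
      lo : a ≤ toℕ v
      lo = subst (λ x → x * n ≤ toℕ v) (sym (toℕ-part v)) (m/n*n≤m (toℕ v) n)
      hi : toℕ v < b
      hi = subst (λ x → toℕ v < suc x * n) (sym (toℕ-part v)) (m<[1+m/n]*n (toℕ v) n)
    ... | no  P′≢P = sym (inRange-false λ (lo , hi) →
            P′≢P (toℕ-injective (trans (toℕ-part v) (m*n≤o<[1+m]*n⇒o/n≡m lo hi))))

WithinPart : ℕ → ℕ → ℕ → Set
WithinPart n a b = ∃ λ j → j * n ≤ a × b ≤ suc j * n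

∣⇒WithinPart : ∀ {d n} t {{_ : NonZero n}} → d ∣ n → WithinPart n (t * d) (suc t * d)
∣⇒WithinPart {d} {n} t {{n≢0}} (divides m n≡m*d) = t / m , lo , hi
  where
  instance
    m≢0 : NonZero m
    m≢0 = m*n≢0⇒m≢0 m {{subst NonZero n≡m*d n≢0}}
  open ≤-Reasoning
  lo : t / m * n ≤ t * d
  lo = begin
    t / m * n        ≡⟨ cong (t / m *_) n≡m*d ⟩
    t / m * (m * d)  ≡⟨ *-assoc (t / m) m d ⟨
    t / m * m * d    ≤⟨ *-monoˡ-≤ d (m/n*n≤m t m) ⟩
    t * d            ∎
  hi : suc t * d ≤ suc (t / m) * n
  hi = begin
    suc t * d              ≤⟨ *-monoˡ-≤ d (m<[1+m/n]*n t m) ⟩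
    suc (t / m) * m * d    ≡⟨ *-assoc (suc (t / m)) m d ⟩
    suc (t / m) * (m * d)  ≡⟨ cong (suc (t / m) *_) n≡m*d ⟨
    suc (t / m) * n        ∎

-- Cuts of an interval

record Cut (N q : ℕ) : Set where
  field
    mark      : ℕ → ℕ
    mark-zero : mark 0 ≡ 0
    mark-last : mark q ≡ N
    mark-step : ∀ i → mark i ≤ mark (suc i)

  mark-mono : ∀ {i j} → i ≤ j → mark i ≤ mark j
  mark-mono i≤j = go (≤⇒≤′ i≤j)
    where
    go : ∀ {i j} → i ≤′ j → mark i ≤ mark j
    go ≤′-refl       = ≤-refl
    go (≤′-step i≤j) = ≤-trans (go i≤j) (mark-step _)

  Piece : ℕ → ℕ → Set
  Piece i x = mark i ≤ x × x < mark (suc i)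

  piece-unique : ∀ {i j x} → Piece i x → Piece j x → i ≡ j
  piece-unique {i} {j} (lo , hi) (lo′ , hi′) with <-cmp i j
  ... | tri< i<j _ _ = contradiction (≤-trans (mark-mono i<j) lo′) (<⇒≱ hi)
  ... | tri≈ _ i≡j _ = i≡j
  ... | tri> _ _ j<i = contradiction (≤-trans (mark-mono j<i) lo) (<⇒≱ hi′)

  piece-exists : ∀ {x} m → x < mark m → ∃ λ i → i < m × Piece i x
  piece-exists {x} zero    x<mark₀ = contradiction (subst (x <_) mark-zero x<mark₀) λ ()
  piece-exists {x} (suc m) x<mark with x <? mark m
  ... | yes x<markₘ = let i , i<m , x∈i = piece-exists m x<markₘ in i , m≤n⇒m≤1+n i<m , x∈i
  ... | no  x≮markₘ = m , ≤-refl , ≮⇒≥ x≮markₘ , x<mark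

  mark-≤-last : ∀ {i} → i ≤ q → mark i ≤ N
  mark-≤-last i≤q = subst (_ ≤_) mark-last (mark-mono i≤q)

open Cut public

AllPieces : ∀ {N q} → (ℕ → ℕ → Set) → Cut N q → Set
AllPieces {q = q} P C = ∀ i → i < q → P (mark C i) (mark C (suc i))

module _ {m n p q : ℕ} (C : Cut m p) (D : Cut n q) where

  appendMark : ℕ → ℕ
  appendMark i with i <? p
  ... | yes _ = mark C i
  ... | no  _ = m + mark D (i ∸ p)

  appendMarkˡ : ∀ {i} → i ≤ p → appendMark i ≡ mark C i
  appendMarkˡ {i} i≤p with i <? p
  ... | yes _   = refl
  ... | no  i≮p = begin
    m + mark D (i ∸ p)  ≡⟨ cong (λ j → m + mark D j) (m≤n⇒m∸n≡0 i≤p) ⟩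
    m + mark D 0        ≡⟨ cong (m +_) (mark-zero D) ⟩
    m + 0               ≡⟨ +-identityʳ m ⟩
    m                   ≡⟨ mark-last C ⟨
    mark C p            ≡⟨ cong (mark C) (≤-antisym p≤i i≤p) ⟩
    mark C i            ∎
    where
    open ≡-Reasoning
    p≤i = ≮⇒≥ i≮p

  appendMarkʳ : ∀ {i} → p ≤ i → appendMark i ≡ m + mark D (i ∸ p)
  appendMarkʳ {i} p≤i with i <? p
  ... | yes i<p = contradiction p≤i (<⇒≱ i<p)
  ... | no  _   = refl

  appendMark-suc : ∀ {i} → p ≤ i → appendMark (suc i) ≡ m + mark D (suc (i ∸ p))
  appendMark-suc p≤i = trans (appendMarkʳ (m≤n⇒m≤1+n p≤i)) (cong (λ j → m + mark D j) (+-∸-assoc 1 p≤i))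

  appendMark-step : ∀ i → appendMark i ≤ appendMark (suc i)
  appendMark-step i with p ≤? i
  ... | yes p≤i = subst₂ _≤_ (sym (appendMarkʳ p≤i)) (sym (appendMark-suc p≤i))
                    (+-monoʳ-≤ m (mark-step D (i ∸ p)))
  ... | no  p≰i = subst₂ _≤_ (sym (appendMarkˡ (<⇒≤ i<p))) (sym (appendMarkˡ i<p)) (mark-step C i)
    where i<p = ≰⇒> p≰i

  _⁀_ : Cut (m + n) (p + q)
  _⁀_ = record
    { mark      = appendMark
    ; mark-zero = trans (appendMarkˡ z≤n) (mark-zero C)
    ; mark-last = begin
        appendMark (p + q)          ≡⟨ appendMarkʳ (m≤m+n p q) ⟩
        m + mark D (p + q ∸ p)      ≡⟨ cong (λ j → m + mark D j) (m+n∸m≡n p q) ⟩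
        m + mark D q                ≡⟨ cong (m +_) (mark-last D) ⟩
        m + n                       ∎
    ; mark-step = appendMark-step
    }
    where open ≡-Reasoning

  ⁀-pieces : ∀ {P : ℕ → ℕ → Set} → AllPieces P C → AllPieces (λ a b → P (m + a) (m + b)) D →
             AllPieces P _⁀_
  ⁀-pieces {P} C-pieces D-pieces i i<p+q with p ≤? i
  ... | yes p≤i = subst₂ P (sym (appendMarkʳ p≤i)) (sym (appendMark-suc p≤i))
                    (D-pieces (i ∸ p) (subst (i ∸ p <_) (m+n∸m≡n p q) (∸-monoˡ-< i<p+q p≤i)))
  ... | no  p≰i = subst₂ P (sym (appendMarkˡ (<⇒≤ i<p))) (sym (appendMarkˡ i<p)) (C-pieces i i<p)
    where i<p = ≰⇒> p≰i

reindex : ∀ {N q q′} → q ≡ q′ → Cut N q → Cut N q′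
reindex q≡q′ C = record
  { mark      = mark C
  ; mark-zero = mark-zero C
  ; mark-last = trans (cong (mark C) (sym q≡q′)) (mark-last C)
  ; mark-step = mark-step C
  }

reindex-pieces : ∀ {N q q′ P} (q≡q′ : q ≡ q′) (C : Cut N q) → AllPieces P C → AllPieces P (reindex q≡q′ C)
reindex-pieces q≡q′ C C-pieces i i<q′ = C-pieces i (subst (i <_) (sym q≡q′) i<q′)

-- The first R pieces have length 1 + s, the later ones length s.
balanced : ℕ → ℕ → ℕ → ℕ
balanced s R u = s * u + u ⊓ R

balanced-step : ∀ s R u → balanced s R (suc u) ≡ balanced s R u + s
                         ⊎ (u < R × balanced s R (suc u) ≡ balanced s R u + suc s)
balanced-step s R u with u <? R
... | yes u<R = inj₂ (u<R , (begin
  s * suc u + suc u ⊓ R      ≡⟨ cong (λ x → s * suc u + x) (m≤n⇒m⊓n≡m u<R) ⟩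
  s * suc u + suc u          ≡⟨ cong (λ x → s * suc u + suc x) (m≤n⇒m⊓n≡m (<⇒≤ u<R)) ⟨
  s * suc u + suc (u ⊓ R)    ≡⟨ arith s u (u ⊓ R) ⟩
  s * u + u ⊓ R + suc s      ∎))
  where
  open ≡-Reasoning
  arith : ∀ s u x → s * suc u + suc x ≡ s * u + x + suc s
  arith = solve-∀
... | no u≮R = inj₁ (begin
  s * suc u + suc u ⊓ R      ≡⟨ cong (s * suc u +_) [1+u]⊓R≡u⊓R ⟩
  s * suc u + u ⊓ R          ≡⟨ arith s u (u ⊓ R) ⟩
  s * u + u ⊓ R + s          ∎)
  where
  open ≡-Reasoning
  arith : ∀ s u x → s * suc u + x ≡ s * u + x + s
  arith = solve-∀
  R≤u = ≮⇒≥ u≮R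
  [1+u]⊓R≡u⊓R : suc u ⊓ R ≡ u ⊓ R
  [1+u]⊓R≡u⊓R = trans (m≥n⇒m⊓n≡n (m≤n⇒m≤1+n R≤u)) (sym (m≥n⇒m⊓n≡n R≤u))

balanced-mono : ∀ s R u → balanced s R u ≤ balanced s R (suc u)
balanced-mono s R u with balanced-step s R u
... | inj₁ e       = subst (balanced s R u ≤_) (sym e) (m≤m+n _ s)
... | inj₂ (_ , e) = subst (balanced s R u ≤_) (sym e) (m≤m+n _ (suc s))

balancedCut : ∀ {N q} s R → R ≤ q → s * q + R ≡ N → Cut N q
balancedCut {N} {q} s R R≤q sq+R≡N = record
  { mark      = balanced s R
  ; mark-zero = cong (_+ 0) (*-zeroʳ s)
  ; mark-last = trans (cong (s * q +_) (m≥n⇒m⊓n≡n R≤q)) sq+R≡N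
  ; mark-step = balanced-mono s R
  }

module _ {N q : ℕ} (C : Cut N q) where

  private
    pieceOf : (v : Fin N) → ∃ λ i → i < q × Piece C i (toℕ v)
    pieceOf v = piece-exists C q (subst (toℕ v <_) (sym (mark-last C)) (toℕ<n v))

  pieceColour : Fin N → Fin q
  pieceColour v = Fin.fromℕ< (proj₁ (proj₂ (pieceOf v)))

  pieceColour-piece : ∀ v → Piece C (toℕ (pieceColour v)) (toℕ v)
  pieceColour-piece v = subst (λ i → Piece C i (toℕ v)) (sym (toℕ-fromℕ< _)) (proj₂ (proj₂ (pieceOf v)))

  module _ (G : Graph N) where

    inClass-pieceColour : ∀ i v → T (inClass G pieceColour i v) → Piece C (toℕ i) (toℕ v)
    inClass-pieceColour i v with pieceColour v ≟ i
    ... | yes refl = λ _ → pieceColour-piece v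

    inClass-pieceColour≡inRange : ∀ i v →
      inClass G pieceColour i v ≡ inRange (mark C (toℕ i)) (mark C (suc (toℕ i))) (toℕ v)
    inClass-pieceColour≡inRange i v with pieceColour v ≟ i
    ... | yes refl = sym (inRange-true (proj₁ (pieceColour-piece v)) (proj₂ (pieceColour-piece v)))
    ... | no  c≢i  = sym (inRange-false λ v∈i → c≢i (toℕ-injective (piece-unique C (pieceColour-piece v) v∈i)))

    length-pieceClass : ∀ i → length (classOf G pieceColour i) ≡ mark C (suc (toℕ i)) ∸ mark C (toℕ i)
    length-pieceClass i = begin
      length (classOf G pieceColour i)
        ≡⟨ length-classOf G pieceColour i ⟩
      ∑[ v < N ] 𝟙 (inClass G pieceColour i v)
        ≡⟨ sum-cong-≗ {N} (λ v → cong 𝟙 (inClass-pieceColour≡inRange i v)) ⟩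
      ∑[ v < N ] 𝟙 (inRange a b (toℕ v))
        ≡⟨ ∑-inRange N a b ⟩
      N ⊓ b ∸ a
        ≡⟨ cong (_∸ a) (m≥n⇒m⊓n≡n (mark-≤-last C (toℕ<n i))) ⟩
      b ∸ a
        ∎
      where
      open ≡-Reasoning
      a = mark C (toℕ i)
      b = mark C (suc (toℕ i))

pieceTreeColouring : ∀ {k n q} .{{_ : NonZero n}} (C : Cut (k * n) q) →
  AllPieces (λ a b → EquitableSize (k * n) q (b ∸ a)) C →
  AllPieces (λ a b → b ≤ 2 + a ⊎ WithinPart n a b) C →
  EqTreeColoring (Kkn k n) q 1
pieceTreeColouring {k} {n} {q} C equitable shape = c , λ i → size i , forest i
  where
  G = Kkn k n
  c = pieceColour C
  size : ∀ i → EquitableSize (k * n) q (length (classOf G c i))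
  size i = subst (EquitableSize (k * n) q) (sym (length-pieceClass C G i)) (equitable (toℕ i) (toℕ<n i))
  forest : ∀ i → ForestMaxDeg G c 1 i
  forest i with shape (toℕ i) (toℕ<n i)
  ... | inj₁ narrow = width-two⇒forest G c (mark C (toℕ i)) λ v v∈i →
          let lo , hi = inClass-pieceColour C G i v v∈i in lo , <-≤-trans hi narrow
  ... | inj₂ (j , j*n≤ , ≤[1+j]*n) = independent⇒forest G c 1 λ u w u∈i w∈i u~w →
          Kkn-adj⇒/≢ {k} u w u~w (trans (inPart u u∈i) (sym (inPart w w∈i)))
    where
    inPart : ∀ v → T (inClass G c i v) → toℕ v / n ≡ j
    inPart v v∈i = let lo , hi = inClass-pieceColour C G i v v∈i in
      m*n≤o<[1+m]*n⇒o/n≡m (≤-trans j*n≤ lo) (<-≤-trans hi ≤[1+j]*n)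

module BalancedColouring (k n q′ : ℕ) {{_ : NonZero n}} where

  private
    N = k * n
    q = suc q′
    s = N / q
    r = N % q

  cut : Cut N q
  cut = balancedCut s r (<⇒≤ (m%n<n N q)) (trans (+-comm (s * q) r) (sym (m≡m%n+[m/n]*n N q)))

  equitable : AllPieces (λ a b → EquitableSize N q (b ∸ a)) cut
  equitable i _ with balanced-step s r i
  ... | inj₁ e         = inj₁ (trans (cong (_∸ balanced s r i) e) (m+n∸m≡n (balanced s r i) s))
  ... | inj₂ (i<r , e) = inj₂ (trans (cong (_∸ balanced s r i) e)
                                 (trans (m+n∸m≡n (balanced s r i) (suc s)) (sym (m%n≢0⇒⌈m/n⌉≡1+m/n N q′ r≢0))))
    where
    r≢0 : r ≢ 0
    r≢0 r≡0 = contradiction (subst (i <_) r≡0 i<r) λ ()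

  narrow-or-within : (s ≤ 2 × 3 ∣ n) ⊎ (r ≡ 0 × s ∣ n) →
                     AllPieces (λ a b → b ≤ 2 + a ⊎ WithinPart n a b) cut
  narrow-or-within shape i _ with shape | balanced-step s r i
  ... | inj₁ (s≤2 , _)   | inj₁ e         = inj₁ (step≤2⇒narrow e s≤2)
  ... | inj₁ (s≤2 , 3∣n) | inj₂ (i<r , e) with m≤n⇒m<n∨m≡n s≤2
  ...   | inj₁ s<2  = inj₁ (step≤2⇒narrow e s<2)
  ...   | inj₂ s≡2  = inj₂ (subst₂ (WithinPart n) (sym [3i]) (sym [3i+3]) (∣⇒WithinPart i 3∣n))
    where
    [3i] : balanced s r i ≡ i * 3
    [3i] = trans (cong₂ (λ x y → x * i + y) s≡2 (m≤n⇒m⊓n≡m (<⇒≤ i<r))) (arith i)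
      where
      arith : ∀ i → 2 * i + i ≡ i * 3
      arith = solve-∀
    [3i+3] : balanced s r (suc i) ≡ suc i * 3
    [3i+3] = trans e (trans (cong₂ _+_ [3i] (cong suc s≡2)) (+-comm (i * 3) 3))
  narrow-or-within _ i _ | inj₂ (r≡0 , s∣n) | inj₁ e =
    inj₂ (subst₂ (WithinPart n) (sym [si]) (sym [si+s]) (∣⇒WithinPart i s∣n))
    where
    [si] : balanced s r i ≡ i * s
    [si] = begin
      s * i + i ⊓ r   ≡⟨ cong (λ x → s * i + i ⊓ x) r≡0 ⟩
      s * i + i ⊓ 0   ≡⟨ cong (s * i +_) (⊓-zeroʳ i) ⟩
      s * i + 0       ≡⟨ +-identityʳ (s * i) ⟩
      s * i           ≡⟨ *-comm s i ⟩
      i * s           ∎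
      where open ≡-Reasoning
    [si+s] : balanced s r (suc i) ≡ suc i * s
    [si+s] = trans e (trans (cong (_+ s) [si]) (+-comm (i * s) s))
  narrow-or-within _ i _ | inj₂ (r≡0 , _)   | inj₂ (i<r , _) = contradiction (subst (i <_) r≡0 i<r) λ ()

  treeColouring : (s ≤ 2 × 3 ∣ n) ⊎ (r ≡ 0 × s ∣ n) → EqTreeColoring (Kkn k n) q 1
  treeColouring shape = pieceTreeColouring {k} cut equitable (narrow-or-within shape)

module PartwiseColouring (n s n′ : ℕ) {{_ : NonZero n}} (s*n′≡n : s * n′ ≡ n) where

  cap : ℕ
  cap = n′ / suc s

  cap≤n′ : cap ≤ n′
  cap≤n′ = m/n≤m n′ (suc s)

  Y*s≤n′∸Y : ∀ {Y} → Y ≤ cap → Y * s ≤ n′ ∸ Y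
  Y*s≤n′∸Y {Y} Y≤cap = m+n≤o⇒m≤o∸n (Y * s) (begin
    Y * s + Y       ≡⟨ +-comm (Y * s) Y ⟩
    Y + Y * s       ≡⟨ *-suc Y s ⟨
    Y * suc s       ≤⟨ *-monoˡ-≤ (suc s) Y≤cap ⟩
    cap * suc s     ≤⟨ m/n*n≤m n′ (suc s) ⟩
    n′              ∎)
    where open ≤-Reasoning

  s*[n′∸Y]+Y*s≡n : ∀ {Y} → Y ≤ n′ → s * (n′ ∸ Y) + Y * s ≡ n
  s*[n′∸Y]+Y*s≡n {Y} Y≤n′ = begin
    s * (n′ ∸ Y) + Y * s      ≡⟨ cong (s * (n′ ∸ Y) +_) (*-comm Y s) ⟩
    s * (n′ ∸ Y) + s * Y      ≡⟨ *-distribˡ-+ s (n′ ∸ Y) Y ⟨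
    s * (n′ ∸ Y + Y)          ≡⟨ cong (s *_) (m∸n+n≡m Y≤n′) ⟩
    s * n′                    ≡⟨ s*n′≡n ⟩
    n                         ∎
    where open ≡-Reasoning

  partCut : ∀ Y → Y ≤ cap → Cut n (n′ ∸ Y)
  partCut Y Y≤cap = balancedCut s (Y * s) (Y*s≤n′∸Y Y≤cap) (s*[n′∸Y]+Y*s≡n (≤-trans Y≤cap cap≤n′))

  Fits : ℕ → ℕ → Set
  Fits a b = (b ≡ a + s ⊎ b ≡ a + suc s) × WithinPart n a b

  Fits-shift : ∀ {a b} → Fits a b → Fits (n + a) (n + b)
  Fits-shift {a} {b} (size , j , j*n≤a , b≤[1+j]*n) =
    Sum.map (λ e → trans (cong (n +_) e) (sym (+-assoc n a s)))
            (λ e → trans (cong (n +_) e) (sym (+-assoc n a (suc s)))) size ,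
    suc j , +-monoʳ-≤ n j*n≤a , +-monoʳ-≤ n b≤[1+j]*n

  partCut-fits : ∀ Y Y≤cap → AllPieces Fits (partCut Y Y≤cap)
  partCut-fits Y Y≤cap i i<q =
    Sum.map₂ proj₂ (balanced-step s (Y * s) i) ,
    0 , z≤n , subst (_ ≤_) (sym (+-identityʳ n)) (mark-≤-last (partCut Y Y≤cap) i<q)

  -- The excess Y is shared out greedily, at most cap per part.
  partsCut : ∀ k Y q → q + Y ≡ k * n′ → Y ≤ k * cap → Σ (Cut (k * n) q) (AllPieces Fits)
  partsCut zero    Y q q+Y≡0 _ =
    balancedCut 0 0 z≤n refl , λ i i<q → contradiction (subst (i <_) (m+n≡0⇒m≡0 q q+Y≡0) i<q) λ ()
  partsCut (suc k) Y q q+Y≡ Y≤ =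
    reindex q₁+q′≡q (first ⁀ rest) ,
    reindex-pieces {P = Fits} q₁+q′≡q (first ⁀ rest)
      (⁀-pieces first rest {P = Fits} (partCut-fits Y₁ Y₁≤cap) λ i i<q′ → Fits-shift (rest-fits i i<q′))
    where
    Y₁ = cap ⊓ Y
    Y′ = Y ∸ cap
    q′ = k * n′ ∸ Y′
    Y₁≤cap : Y₁ ≤ cap
    Y₁≤cap = m⊓n≤m cap Y
    Y′≤k*cap : Y′ ≤ k * cap
    Y′≤k*cap = m≤n+o⇒m∸n≤o Y cap Y≤
    Y′≤k*n′ : Y′ ≤ k * n′
    Y′≤k*n′ = ≤-trans Y′≤k*cap (*-monoʳ-≤ k cap≤n′)
    first = partCut Y₁ Y₁≤cap
    rest-with-fits = partsCut k Y′ q′ (m∸n+n≡m Y′≤k*n′) Y′≤k*cap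
    rest = proj₁ rest-with-fits
    rest-fits = proj₂ rest-with-fits
    q₁+q′≡q : n′ ∸ Y₁ + q′ ≡ q
    q₁+q′≡q = +-cancelʳ-≡ Y _ _ (begin
      n′ ∸ Y₁ + q′ + Y             ≡⟨ cong (n′ ∸ Y₁ + q′ +_) (m⊓n+n∸m≡n cap Y) ⟨
      n′ ∸ Y₁ + q′ + (Y₁ + Y′)     ≡⟨ +-interchange (n′ ∸ Y₁) q′ Y₁ Y′ ⟩
      (n′ ∸ Y₁ + Y₁) + (q′ + Y′)   ≡⟨ cong₂ _+_ (m∸n+n≡m (≤-trans Y₁≤cap cap≤n′)) (m∸n+n≡m Y′≤k*n′) ⟩
      n′ + k * n′                  ≡⟨ q+Y≡ ⟨
      q + Y                        ∎)
      where open ≡-Reasoning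

  treeColouring : ∀ k q′ → (k * n) / suc q′ ≡ s → (k * n) % suc q′ ≢ 0 →
                  suc q′ ≤ k * n′ → k * n′ ∸ suc q′ ≤ k * cap → EqTreeColoring (Kkn k n) (suc q′) 1
  treeColouring k q′ N/q≡s r≢0 q≤k*n′ Y≤k*cap =
    pieceTreeColouring {k} cut (λ i i<q → equitable (proj₁ (fits i i<q))) (λ i i<q → inj₂ (proj₂ (fits i i<q)))
    where
    cut-with-fits = partsCut k (k * n′ ∸ suc q′) (suc q′) (m+[n∸m]≡n q≤k*n′) Y≤k*cap
    cut = proj₁ cut-with-fits
    fits = proj₂ cut-with-fits
    equitable : ∀ {a b} → b ≡ a + s ⊎ b ≡ a + suc s → EquitableSize (k * n) (suc q′) (b ∸ a)
    equitable {a} (inj₁ b≡a+s) = inj₁ (trans (cong (_∸ a) b≡a+s) (trans (m+n∸m≡n a s) (sym N/q≡s)))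
    equitable {a} (inj₂ b≡a+1+s) = inj₂ (trans (cong (_∸ a) b≡a+1+s)
      (trans (m+n∸m≡n a (suc s)) (sym (trans (m%n≢0⇒⌈m/n⌉≡1+m/n (k * n) q′ r≢0) (cong suc N/q≡s)))))

-- The lower bound

module ClassesWithinParts {k n q : ℕ} .{{_ : NonZero n}} (c : Fin (k * n) → Fin q)
  (forest : ∀ i → ForestMaxDeg (Kkn k n) c 1 i)
  (large : ∀ i → 3 ≤ length (classOf (Kkn k n) c i)) where

  private
    G = Kkn k n
    N = k * n

  -- u has at most one neighbour in its class, so at least two members of the class lie in u's
  -- part; a member w outside that part would be adjacent to both.
  class-within-part : ∀ i u w → T (inClass G c i u) → T (inClass G c i w) → part k n w ≡ part k n u
  class-within-part i u w u∈i w∈i with part k n w ≟ part k n u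
  ... | yes Pw≡Pu = Pw≡Pu
  ... | no  Pw≢Pu = contradiction (proj₂ (forest i) w w∈i) (<⇒≱ (≤-trans 2≤A A≤deg-w))
    where
    sameAs-u otherThan-u : Fin N → ℕ
    sameAs-u  z = 𝟙 (inClass G c i z ∧ does (part k n u ≟ part k n z))
    otherThan-u z = 𝟙 (inClass G c i z ∧ not (does (part k n u ≟ part k n z)))
    A = ∑[ z < N ] sameAs-u z
    D = ∑[ z < N ] otherThan-u z
    size≡A+D : length (classOf G c i) ≡ A + D
    size≡A+D = trans (length-classOf G c i)
                 (trans (sum-cong-≗ {N} (λ z → 𝟙-split (inClass G c i z) _)) (∑-distrib-+ sameAs-u otherThan-u))
    D≤1 : D ≤ 1
    D≤1 = subst (_≤ 1) (degIn-∑ G c i u) (proj₂ (forest i) u u∈i)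
    2≤A : 2 ≤ A
    2≤A = +-cancelʳ-≤ D 2 A (≤-trans (+-monoʳ-≤ 2 D≤1) (subst (3 ≤_) size≡A+D (large i)))
    w-sees-sameAs-u : ∀ z → sameAs-u z ≤ 𝟙 (inClass G c i z ∧ adj G w z)
    w-sees-sameAs-u z with inClass G c i z
    ... | false = z≤n
    ... | true with part k n u ≟ part k n z
    ...   | no  _     = z≤n
    ...   | yes Pu≡Pz with part k n w ≟ part k n z
    ...     | yes Pw≡Pz = contradiction (trans Pw≡Pz (sym Pu≡Pz)) Pw≢Pu
    ...     | no  _     = ≤-refl
    A≤deg-w : A ≤ degIn G c i w
    A≤deg-w = subst (A ≤_) (sym (degIn-∑ G c i w)) (∑-mono-≤ w-sees-sameAs-u)

  representative : ∀ i → ∃ λ v → T (inClass G c i v)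
  representative i =
    ∑-𝟙-witness (inClass G c i) (subst (0 <_) (length-classOf G c i) (≤-trans (s≤s z≤n) (large i)))

  partOf : Fin q → Fin k
  partOf i = part k n (proj₁ (representative i))

  partOf-colour : ∀ v → partOf (c v) ≡ part k n v
  partOf-colour v = sym (class-within-part (c v) _ v (proj₂ (representative (c v))) v∈cv)
    where
    v∈cv : T (inClass G c (c v) v)
    v∈cv with c v ≟ c v
    ... | yes _    = _
    ... | no  cv≢cv = cv≢cv refl

  classesIn : Fin k → ℕ
  classesIn P = ∑[ i < q ] 𝟙 (does (partOf i ≟ P))

  ∑-classesIn : ∑[ P < k ] classesIn P ≡ q
  ∑-classesIn = begin
    ∑[ P < k ] ∑[ i < q ] 𝟙 (does (partOf i ≟ P))  ≡⟨ ∑-comm (λ P i → 𝟙 (does (partOf i ≟ P))) ⟩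
    ∑[ i < q ] ∑[ P < k ] 𝟙 (does (partOf i ≟ P))  ≡⟨ sum-cong-≗ {q} (λ i → ∑-𝟙-≟ k (partOf i)) ⟩
    ∑[ i < q ] 1                                  ≡⟨ ∑-const q 1 ⟩
    q * 1                                         ≡⟨ *-identityʳ q ⟩
    q                                             ∎
    where open ≡-Reasoning

  part-size : ∀ P → ∑[ i < q ] (𝟙 (does (partOf i ≟ P)) * length (classOf G c i)) ≡ n
  part-size P = begin
    ∑[ i < q ] (𝟙 (does (partOf i ≟ P)) * length (classOf G c i))
      ≡⟨ sum-cong-≗ {q} (λ i → cong (𝟙 (does (partOf i ≟ P)) *_) (length-classOf G c i)) ⟩
    ∑[ i < q ] (𝟙 (does (partOf i ≟ P)) * ∑[ v < N ] 𝟙 (does (c v ≟ i)))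
      ≡⟨ ∑-fibres N q c (λ i → 𝟙 (does (partOf i ≟ P))) ⟨
    ∑[ v < N ] 𝟙 (does (partOf (c v) ≟ P))
      ≡⟨ sum-cong-≗ {N} (λ v → cong (λ Q → 𝟙 (does (Q ≟ P))) (partOf-colour v)) ⟩
    ∑[ v < N ] 𝟙 (does (part k n v ≟ P))
      ≡⟨ ∑-part P ⟩
    n ∎
    where open ≡-Reasoning

  classesIn-bounds : ∀ {lo hi} → (∀ i → lo ≤ length (classOf G c i) × length (classOf G c i) ≤ hi) →
                     ∀ P → lo * classesIn P ≤ n × n ≤ hi * classesIn P
  classesIn-bounds {lo} {hi} sizes P = lower , upper
    where
    open ≤-Reasoning
    inP : Fin q → ℕ
    inP i = 𝟙 (does (partOf i ≟ P))
    lower : lo * classesIn P ≤ n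
    lower = begin
      lo * classesIn P                               ≡⟨ *-distribˡ-sum {q} lo inP ⟩
      ∑[ i < q ] (lo * inP i)                        ≤⟨ ∑-mono-≤ (λ i → ≤-reflexive (*-comm lo (inP i))) ⟩
      ∑[ i < q ] (inP i * lo)                        ≤⟨ ∑-mono-≤ (λ i → *-monoʳ-≤ (inP i) (proj₁ (sizes i))) ⟩
      ∑[ i < q ] (inP i * length (classOf G c i))    ≡⟨ part-size P ⟩
      n                                              ∎
    upper : n ≤ hi * classesIn P
    upper = begin
      n                                              ≡⟨ part-size P ⟨
      ∑[ i < q ] (inP i * length (classOf G c i))    ≤⟨ ∑-mono-≤ (λ i → *-monoʳ-≤ (inP i) (proj₂ (sizes i))) ⟩
      ∑[ i < q ] (inP i * hi)                        ≤⟨ ∑-mono-≤ (λ i → ≤-reflexive (*-comm (inP i) hi)) ⟩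
      ∑[ i < q ] (hi * inP i)                        ≡⟨ *-distribˡ-sum {q} hi inP ⟨
      hi * classesIn P                               ∎

module Arboricity (k′ b′ d₀ : ℕ) (4≤d : 4 ≤ suc d₀) (d∤n : ¬ suc d₀ ∣ 3 * suc b′)
                  (<d⇒∣n : ∀ e → 4 ≤ e → e < suc d₀ → e ∣ 3 * suc b′) where

  k = 2 + k′
  b = suc b′
  n = 3 * b
  N = k * n
  d = suc d₀
  a = n / d

  3∣n : 3 ∣ n
  3∣n = divides b (*-comm 3 b)

  3≤e<d⇒e∣n : ∀ e → 3 ≤ e → e < d → e ∣ n
  3≤e<d⇒e∣n e 3≤e e<d with m≤n⇒m<n∨m≡n 3≤e
  ... | inj₁ 3<e  = <d⇒∣n e 3<e e<d
  ... | inj₂ refl = 3∣n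

  ⌈n/d⌉≡1+a : ⌈ n / d ⌉ ≡ suc a
  ⌈n/d⌉≡1+a = m%n≢0⇒⌈m/n⌉≡1+m/n n d₀ λ r≡0 → d∤n (m%n≡0⇒n∣m n d r≡0)

  a*d<n : a * d < n
  a*d<n = ≤∧≢⇒< (m/n*n≤m n d) λ a*d≡n → d∤n (divides a (sym a*d≡n))

  n<[1+a]*d : n < suc a * d
  n<[1+a]*d = m<[1+m/n]*n n d

  a<b : a < b
  a<b = *-cancelʳ-< 4 a b (begin-strict
    a * 4    ≤⟨ *-monoʳ-≤ a 4≤d ⟩
    a * d    ≤⟨ m/n*n≤m n d ⟩
    3 * b    <⟨ *-monoˡ-< b {3} {4} ≤-refl ⟩
    4 * b    ≡⟨ *-comm 4 b ⟩
    b * 4    ∎)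
    where open ≤-Reasoning

  module LargeClasses (q′ : ℕ) (k[1+a]≤q : k * suc a ≤ suc q′) (3≤s : 3 ≤ N / suc q′) where

    q = suc q′
    s = N / q

    instance
      s≢0 : NonZero s
      s≢0 = >-nonZero (≤-trans (s≤s z≤n) 3≤s)

    N<[1+s]*q : N < suc s * q
    N<[1+s]*q = m<[1+m/n]*n N q

    s<d : s < d
    s<d = ≰⇒> λ d≤s → <⇒≱ (begin-strict
      N                 <⟨ *-monoʳ-< k n<[1+a]*d ⟩
      k * (suc a * d)   ≡⟨ *-assoc k (suc a) d ⟨
      k * suc a * d     ≤⟨ *-monoˡ-≤ d k[1+a]≤q ⟩
      q * d             ≤⟨ *-monoʳ-≤ q d≤s ⟩
      q * s             ≡⟨ *-comm q s ⟩
      s * q             ∎) (m/n*n≤m N q)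
      where open ≤-Reasoning

    s∣n : s ∣ n
    s∣n = 3≤e<d⇒e∣n s 3≤s s<d

    n′ = n / s
    cap = n′ / suc s

    s*n′≡n : s * n′ ≡ n
    s*n′≡n = m*[n/m]≡n s∣n

    N≡s*[k*n′] : N ≡ s * (k * n′)
    N≡s*[k*n′] = trans (cong (k *_) (sym s*n′≡n)) (x*[y*z]≡y*[x*z] k s n′)

    q≤k*n′ : q ≤ k * n′
    q≤k*n′ = *-cancelˡ-≤ s (subst (s * q ≤_) N≡s*[k*n′] (m/n*n≤m N q))

    1+s<d⇒k*n′≤q+k*cap : suc s < d → k * n′ ≤ q + k * cap
    1+s<d⇒k*n′≤q+k*cap 1+s<d = begin
      k * n′                      ≡⟨ cong (k *_) n′≡cap*[1+s] ⟩
      k * (cap * suc s)           ≡⟨ arith k cap s ⟩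
      k * cap * s + k * cap       ≤⟨ +-monoˡ-≤ (k * cap) (<⇒≤ k*cap*s<q) ⟩
      q + k * cap                 ∎
      where
      open ≤-Reasoning
      arith : ∀ k c s → k * (c * suc s) ≡ k * c * s + k * c
      arith = solve-∀
      1+s∣n′ : suc s ∣ n′
      1+s∣n′ = ∣m+n∣m⇒∣n (subst (suc s ∣_) (+-comm n′ (s * n′)) (m∣m*n n′))
                          (subst (suc s ∣_) (sym s*n′≡n) (3≤e<d⇒e∣n (suc s) (m≤n⇒m≤1+n 3≤s) 1+s<d))
      n′≡cap*[1+s] : n′ ≡ cap * suc s
      n′≡cap*[1+s] = sym (m/n*n≡m 1+s∣n′)
      k*cap*s<q : k * cap * s < q
      k*cap*s<q = *-cancelʳ-< (suc s) _ _ (begin-strict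
        k * cap * s * suc s       ≡⟨ arith′ k cap s ⟩
        k * (s * (cap * suc s))   ≡⟨ cong (λ x → k * (s * x)) n′≡cap*[1+s] ⟨
        k * (s * n′)              ≡⟨ cong (k *_) s*n′≡n ⟩
        N                         <⟨ N<[1+s]*q ⟩
        suc s * q                 ≡⟨ *-comm (suc s) q ⟩
        q * suc s                 ∎)
        where
        arith′ : ∀ k c s → k * c * s * suc s ≡ k * (s * (c * suc s))
        arith′ = solve-∀

    d≡1+s⇒k*n′≤q+k*cap : d ≡ suc s → k * n′ ≤ q + k * cap
    d≡1+s⇒k*n′≤q+k*cap d≡1+s = begin
      k * n′                      ≤⟨ *-monoʳ-≤ k n′≤1+a+cap ⟩
      k * (suc a + cap)           ≡⟨ *-distribˡ-+ k (suc a) cap ⟩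
      k * suc a + k * cap         ≤⟨ +-monoˡ-≤ (k * cap) k[1+a]≤q ⟩
      q + k * cap                 ∎
      where
      open ≤-Reasoning
      arith : ∀ c a s → suc c * suc s + suc a * suc s ≡ suc (suc a + c) * suc s
      arith = solve-∀
      n<[1+a]*[1+s] : n < suc a * suc s
      n<[1+a]*[1+s] = subst (λ x → n < suc a * x) d≡1+s n<[1+a]*d
      n′≤1+a+cap : n′ ≤ suc a + cap
      n′≤1+a+cap = ≤-pred (*-cancelʳ-< (suc s) n′ (suc (suc a + cap)) (begin-strict
        n′ * suc s                       ≡⟨ *-suc n′ s ⟩
        n′ + n′ * s                      ≡⟨ cong (n′ +_) (trans (*-comm n′ s) s*n′≡n) ⟩
        n′ + n                           <⟨ +-mono-< (m<[1+m/n]*n n′ (suc s)) n<[1+a]*[1+s] ⟩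
        suc cap * suc s + suc a * suc s  ≡⟨ arith cap a s ⟩
        suc (suc a + cap) * suc s        ∎))

    k*n′≤q+k*cap : k * n′ ≤ q + k * cap
    k*n′≤q+k*cap with suc s <? d
    ... | yes 1+s<d = 1+s<d⇒k*n′≤q+k*cap 1+s<d
    ... | no  1+s≮d = d≡1+s⇒k*n′≤q+k*cap (≤-antisym (≮⇒≥ 1+s≮d) s<d)

    colourable : EqTreeColoring (Kkn k n) q 1
    colourable with N % q ≟ℕ 0
    ... | yes r≡0 = BalancedColouring.treeColouring k n q′ (inj₂ (r≡0 , s∣n))
    ... | no  r≢0 = PartwiseColouring.treeColouring n s n′ s*n′≡n k q′ refl r≢0 q≤k*n′
                      (m≤n+o⇒m∸n≤o (k * n′) q k*n′≤q+k*cap)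

  colourable : ∀ q → k * suc a ≤ q → EqTreeColoring (Kkn k n) q 1
  colourable (suc q′) k[1+a]≤q with N / suc q′ ≤? 2
  ... | yes s≤2 = BalancedColouring.treeColouring k n q′ (inj₁ (s≤2 , 3∣n))
  ... | no  s≰2 = LargeClasses.colourable q′ k[1+a]≤q (≰⇒> s≰2)

  -- k(1 + a) − 1, written as a successor.
  q₀ : ℕ
  q₀ = suc (k′ + k * a)

  1+q₀≡k*[1+a] : suc q₀ ≡ k * suc a
  1+q₀≡k*[1+a] = sym (*-suc k a)

  module Uncolourable (c : Fin N → Fin q₀)
    (c-ok : ∀ i → EquitableSize N q₀ (length (classOf (Kkn k n) c i)) × ForestMaxDeg (Kkn k n) c 1 i) where

    s₀ = N / q₀

    sizes : ∀ i → s₀ ≤ length (classOf (Kkn k n) c i) × length (classOf (Kkn k n) c i) ≤ suc s₀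
    sizes i = EquitableSize-bounds {N} {k′ + k * a} (proj₁ (c-ok i))

    3≤s₀ : 3 ≤ s₀
    3≤s₀ = subst (_≤ s₀) (m*n/n≡m 3 q₀) (/-monoˡ-≤ q₀ (begin
      3 * q₀          ≤⟨ *-monoʳ-≤ 3 (n≤1+n q₀) ⟩
      3 * suc q₀      ≡⟨ cong (3 *_) 1+q₀≡k*[1+a] ⟩
      3 * (k * suc a) ≤⟨ *-monoʳ-≤ 3 (*-monoʳ-≤ k a<b) ⟩
      3 * (k * b)     ≡⟨ x*[y*z]≡y*[x*z] 3 k b ⟩
      N               ∎))
      where open ≤-Reasoning

    open ClassesWithinParts c (proj₂ ∘ c-ok) (λ i → ≤-trans 3≤s₀ (proj₁ (sizes i)))

    1+s₀≤d⇒⊥ : suc s₀ ≤ d → ⊥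
    1+s₀≤d⇒⊥ 1+s₀≤d = <⇒≱ (subst (q₀ <_) 1+q₀≡k*[1+a] ≤-refl) (begin
      k * suc a                ≡⟨ ∑-const k (suc a) ⟨
      ∑[ P < k ] suc a         ≤⟨ ∑-mono-≤ 1+a≤J ⟩
      ∑[ P < k ] classesIn P   ≡⟨ ∑-classesIn ⟩
      q₀                       ∎)
      where
      open ≤-Reasoning
      1+a≤J : ∀ P → suc a ≤ classesIn P
      1+a≤J P = *-cancelʳ-< d a (classesIn P) (begin-strict
        a * d                    <⟨ a*d<n ⟩
        n                        ≤⟨ proj₂ (classesIn-bounds sizes P) ⟩
        suc s₀ * classesIn P     ≤⟨ *-monoˡ-≤ (classesIn P) 1+s₀≤d ⟩
        d * classesIn P          ≡⟨ *-comm d (classesIn P) ⟩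
        classesIn P * d          ∎)

    d≤s₀⇒⊥ : d ≤ s₀ → ⊥
    d≤s₀⇒⊥ d≤s₀ = <⇒≱ (s≤s (m≤n+m (k * a) k′)) (begin
      q₀                       ≡⟨ ∑-classesIn ⟨
      ∑[ P < k ] classesIn P   ≤⟨ ∑-mono-≤ J≤a ⟩
      ∑[ P < k ] a             ≡⟨ ∑-const k a ⟩
      k * a                    ∎)
      where
      open ≤-Reasoning
      J≤a : ∀ P → classesIn P ≤ a
      J≤a P = ≤-pred (*-cancelʳ-< d (classesIn P) (suc a) (begin-strict
        classesIn P * d          ≤⟨ *-monoʳ-≤ (classesIn P) d≤s₀ ⟩
        classesIn P * s₀         ≡⟨ *-comm (classesIn P) s₀ ⟩
        s₀ * classesIn P         ≤⟨ proj₁ (classesIn-bounds sizes P) ⟩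
        n                        <⟨ n<[1+a]*d ⟩
        suc a * d                ∎))

    absurd : ⊥
    absurd with suc s₀ ≤? d
    ... | yes 1+s₀≤d = 1+s₀≤d⇒⊥ 1+s₀≤d
    ... | no  1+s₀≰d = d≤s₀⇒⊥ (≤-pred (≰⇒> 1+s₀≰d))

  uncolourable : ¬ EqTreeColoring (Kkn k n) q₀ 1
  uncolourable (c , c-ok) = Uncolourable.absurd c c-ok

  isStrongEqVArb : IsStrongEqVArb (Kkn k n) 1 (k * suc a)
  isStrongEqVArb = colourable , least
    where
    least : ∀ p′ → (∀ q → p′ ≤ q → EqTreeColoring (Kkn k n) q 1) → k * suc a ≤ p′
    least p′ colourable-from-p′ with k * suc a ≤? p′
    ... | yes k[1+a]≤p′ = k[1+a]≤p′
    ... | no  k[1+a]≰p′ = contradiction (colourable-from-p′ q₀ p′≤q₀) uncolourable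
      where p′≤q₀ = ≤-pred (subst (p′ <_) (sym 1+q₀≡k*[1+a]) (≰⇒> k[1+a]≰p′))

  isP : IsP (k * b) (replicate k n) (k * suc a)
  isP = d , (3≤d , inj₁ (Fin.zero , Fin.suc Fin.zero , (λ ()) , d∤n , d∤n) , minimal) , sym ∑⌈n/d⌉≡k*[1+a]
    where
    ns = replicate k n
    ⌈N/kb⌉≡3 : ⌈ sum ns / k * b ⌉ ≡ 3
    ⌈N/kb⌉≡3 = trans (cong (λ x → ⌈ x / k * b ⌉) (trans (sum-replicate k n) (x*[y*z]≡y*[x*z] k 3 b)))
                     (⌈m*n/n⌉≡m 3 (b′ + suc k′ * b))
    3≤d : ⌈ sum ns / k * b ⌉ ≤ d
    3≤d = subst (_≤ d) (sym ⌈N/kb⌉≡3) (≤-trans (n≤1+n 3) 4≤d)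
    minimal : ∀ d′ → ⌈ sum ns / k * b ⌉ ≤ d′ → d′ < d → ¬ PCond ns d′
    minimal (suc d₁) 3≤d′ d′<d = divisor⇒¬PCond
      where
      d′ = suc d₁
      d′∣n : d′ ∣ n
      d′∣n = 3≤e<d⇒e∣n d′ (subst (_≤ d′) ⌈N/kb⌉≡3 3≤d′) d′<d
      divisor⇒¬PCond : ¬ PCond ns d′
      divisor⇒¬PCond (inj₁ (i , _ , _ , d′∤nsᵢ , _)) =
        d′∤nsᵢ (subst (d′ ∣_) (sym (lookup-replicate k n i)) d′∣n)
      divisor⇒¬PCond (inj₂ (i , _ , [1+d′]*[nᵢ/d′]<nᵢ)) = <⇒≱ [1+d′]*[n/d′]<n n≤[1+d′]*[n/d′]
        where
        [1+d′]*[n/d′]<n : suc d′ * (n / d′) < n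
        [1+d′]*[n/d′]<n = subst (λ m → suc d′ * (m / d′) < m) (lookup-replicate k n i) [1+d′]*[nᵢ/d′]<nᵢ
        n≤[1+d′]*[n/d′] : n ≤ suc d′ * (n / d′)
        n≤[1+d′]*[n/d′] = begin
          n                       ≤⟨ m≤n+m n (n / d′) ⟩
          n / d′ + n              ≡⟨ cong (n / d′ +_) (m*[n/m]≡n d′∣n) ⟨
          n / d′ + d′ * (n / d′)  ∎
          where open ≤-Reasoning
    ∑⌈n/d⌉≡k*[1+a] : sum (map (λ m → ⌈ m / d ⌉) ns) ≡ k * suc a
    ∑⌈n/d⌉≡k*[1+a] = trans (cong sum (map-replicate (λ m → ⌈ m / d ⌉) k n))
                           (trans (sum-replicate k ⌈ n / d ⌉) (cong (k *_) ⌈n/d⌉≡1+a))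

lemma14 : (k b : ℕ) → 2 ≤ k → 1 ≤ b →
  Σ ℕ (λ v → IsP (k * b) (replicate k (3 * b)) v × IsStrongEqVArb (Kkn k (3 * b)) 1 v)
lemma14 (suc (suc k′)) (suc b′) _ _ with least-non-divisor (3 * suc b′)
... | suc d₀ , 4≤d , d∤n , below = k * suc a , isP , isStrongEqVArb
  where open Arboricity k′ b′ d₀ 4≤d d∤n below
lemma14 (suc (suc _)) zero _ ()
lemma14 (suc zero)    _    (s≤s ()) _
lemma14 zero          _    () _
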